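{- Let $n\geq 3$, $k\geq 1$, $a=[n,n+1,\ldots,n+k]$, $b=F_nF_{n+1}\cdots F_{n+k}$ and $f_k(n)=\frac{F_nF_{n+1}\cdots F_{n+k}}{[F_n,F_{n+1},\ldots,F_{n+k}]}$. Then: (i) $b\mid f_k(n)F_{aj}$ for every integer $j\geq 1$. (ii) $z(b)=aj$ where $j$ is the smallest positive integer such that $b\mid F_{aj}$. In fact, $j$ is the smallest positive integer such that $v_p(b)\le v_p(F_{aj})$ for every prime $p$ dividing $f_k(n)$.
   Context: $F_n$ is the $n$th Fibonacci number ($F_1=F_2=1$, $F_n=F_{n-1}+F_{n-2}$). For a positive integer $m$, $z(m)$ (the order of appearance of $m$ in the Fibonacci sequence) is the smallest positive integer $k$ with $m\mid F_k$. $[\cdots]$ denotes lcm, and $v_p$ the $p$-adic valuation. -}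

module Defs where

open import Data.Nat using (ℕ; zero; suc; _+_; _*_; _^_; _≤_; _<_; _/_)
open import Data.Nat.Divisibility using (_∣_; _∣?_)
open import Data.Nat.LCM using (lcm)
open import Data.List using (List; map; upTo; foldr)
open import Data.Nat.ListAction using (product)
open import Data.Product using (_×_)
open import Relation.Nullary using (¬_; yes; no)

fib : ℕ → ℕ
fib zero = zero
fib (suc zero) = suc zero
fib (suc (suc n)) = fib (suc n) + fib n

range : ℕ → ℕ → List ℕ
range n k = map (λ i → n + i) (upTo (suc k))

lcmList : List ℕ → ℕ
lcmList = foldr lcm 1

lcmRange : ℕ → ℕ → ℕ
lcmRange n k = lcmList (range n k)

fibProd : ℕ → ℕ → ℕ
fibProd n k = product (map fib (range n k))

fibLcm : ℕ → ℕ → ℕ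
fibLcm n k = lcmList (map fib (range n k))

-- natural-number division, with an (irrelevant here) convention for divisor 0
divN : ℕ → ℕ → ℕ
divN m zero = zero
divN m (suc d) = m / suc d

fk : ℕ → ℕ → ℕ
fk k n = divN (fibProd n k) (fibLcm n k)

IsOrderOfAppearance : ℕ → ℕ → Set
IsOrderOfAppearance m k =
  (0 < k) × (m ∣ fib k) × (∀ j → 0 < j → m ∣ fib j → k ≤ j)

IsLeastPos : (ℕ → Set) → ℕ → Set
IsLeastPos P j = (0 < j) × P j × (∀ i → 0 < i → P i → j ≤ i)

-- p-adic valuation v_p(m) (for p ≥ 2, m ≥ 1; 0 by convention otherwise),
-- computed by repeated division with fuel
valFuel : ℕ → ℕ → ℕ → ℕ
valFuel zero p m = zero
valFuel (suc fuel) zero m = zero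
valFuel (suc fuel) (suc zero) m = zero
valFuel (suc fuel) (suc (suc q)) zero = zero
valFuel (suc fuel) (suc (suc q)) (suc m) with suc (suc q) ∣? suc m
... | yes _ = suc (valFuel fuel (suc (suc q)) (suc m / suc (suc q)))
... | no _ = zero

val : ℕ → ℕ → ℕ
val p m = valFuel m p m

{-# OPTIONS --safe #-}
-- b = f_k(n) · [F_n, …, F_{n+k}], and every F_m (m ∈ [n, n+k]) divides F_N once a ∣ N; this gives (i),
-- and reduces b ∣ F_{aj} to the valuations at the primes of f_k(n). Since F_m ∣ F_N forces m ∣ N for
-- m ≥ 3, any N with b ∣ F_N is a multiple of a, so z(b) = aj for the least j with b ∣ F_{aj}. Such a j
-- exists by lifting the exponent: d ∣ F_t implies d^{r+1} ∣ F_{t d^r}, and b ∣ F_a^{k+1}.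
module Submission where

open import Defs
open import Data.Nat
open import Data.Nat.Properties
open import Data.Nat.Divisibility
open import Data.Nat.DivMod using (_%_; _/_; m≡m%n+[m/n]*n; m%n<n; m*[n/m]≡n; m/n<m; m/n*n≡m)
open import Data.Nat.Coprimality using (Coprime; coprime-divisor)
open import Data.Nat.Primality using (Prime; prime⇒nonTrivial; euclidsLemma)
open import Data.Nat.Primality.Factorisation using (PrimeFactorisation; factorise)
open import Data.Nat.LCM using (lcm-least; m∣lcm[m,n]; n∣lcm[m,n])
open import Data.Nat.ListAction using (product)
open import Data.Nat.ListAction.Properties using (∈⇒∣product; product≢0)
open import Data.Nat.Induction using (<-rec)
open import Data.Nat.Tactic.RingSolver using (solve-∀)
open import Data.Integer as ℤ using (ℤ; +_)
import Data.Integer.Properties as ℤ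
import Data.Integer.Divisibility.Signed as ℤ
import Data.Integer.Tactic.RingSolver as ℤ-Solver
open import Data.List using ([]; _∷_; length; map)
open import Data.List.Membership.Propositional using (_∈_)
open import Data.List.Membership.Propositional.Properties using (∈-map⁺; ∈-map⁻)
open import Data.List.Relation.Unary.All using (All; []; _∷_; tabulate; lookup)
open import Data.List.Relation.Unary.All.Properties using (map⁺)
open import Data.List.Relation.Unary.Any using (here; there)
open import Data.Empty using (⊥-elim)
open import Data.Product using (∃; _×_; _,_; proj₁; proj₂)
open import Data.Sum using ([_,_]′)
open import Function using (id; _∘_)
open import Relation.Binary.PropositionalEquality
open import Relation.Nullary using (¬_; yes; no)
open import Relation.Nullary.Decidable using (_×-dec_)
open import Relation.Unary using (Decidable)

*-pos : ∀ {m n} → 0 < m → 0 < n → 0 < m * n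
*-pos {suc _} {suc _} _ _ = z<s

∣⇒pos : ∀ {d m} → d ∣ m → 0 < m → 0 < d
∣⇒pos {zero} 0∣m 0<m = subst (0 <_) (0∣⇒≡0 0∣m) 0<m
∣⇒pos {suc _} _ _ = z<s

fib-+ : ∀ a b → fib (suc (a + b)) ≡ fib (suc a) * fib (suc b) + fib a * fib b
fib-+ zero b = sym (trans (+-identityʳ _) (+-identityʳ _))
fib-+ (suc zero) b = cong₂ _+_ (sym (*-identityˡ (fib (suc b)))) (sym (*-identityˡ (fib b)))
fib-+ (suc (suc a)) b rewrite fib-+ (suc a) b | fib-+ a b = step (fib (suc a)) (fib a) (fib (suc b)) (fib b)
  where
  step : ∀ x₁ x₀ y₁ y₀ →
    (x₁ + x₀) * y₁ + x₁ * y₀ + (x₁ * y₁ + x₀ * y₀) ≡ (x₁ + x₀ + x₁) * y₁ + (x₁ + x₀) * y₀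
  step = solve-∀

fib-pos : ∀ {n} → 0 < n → 0 < fib n
fib-pos {suc zero} _ = z<s
fib-pos {suc (suc n)} _ = ≤-trans (fib-pos {suc n} z<s) (m≤m+n (fib (suc n)) (fib n))

fib-mono-≤ : ∀ {m n} → m ≤ n → fib m ≤ fib n
fib-mono-≤ m≤n = mono (≤⇒≤′ m≤n)
  where
  fib≤fib[1+n] : ∀ n → fib n ≤ fib (suc n)
  fib≤fib[1+n] zero = z≤n
  fib≤fib[1+n] (suc n) = m≤m+n (fib (suc n)) (fib n)
  mono : ∀ {m n} → m ≤′ n → fib m ≤ fib n
  mono ≤′-refl = ≤-refl
  mono {n = suc n} (≤′-step m≤′n) = ≤-trans (mono m≤′n) (fib≤fib[1+n] n)

fib-mono-< : ∀ {m n} → 3 ≤ n → m < n → fib m < fib n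
fib-mono-< {m} {suc (suc (suc n))} (s≤s (s≤s (s≤s _))) (s≤s m≤2+n) =
  ≤-<-trans (fib-mono-≤ m≤2+n) (m<m+n (fib (suc (suc n))) (fib-pos {suc n} z<s))

fib-coprime-suc : ∀ n → Coprime (fib n) (fib (suc n))
fib-coprime-suc zero (_ , d∣1) = ∣1⇒≡1 d∣1
fib-coprime-suc (suc n) (d∣F[1+n] , d∣F[2+n]) =
  fib-coprime-suc n (∣m+n∣m⇒∣n d∣F[2+n] d∣F[1+n] , d∣F[1+n])

fib-∣-fib-* : ∀ m t → fib m ∣ fib (t * m)
fib-∣-fib-* m zero = fib m ∣0
fib-∣-fib-* zero (suc t) rewrite *-zeroʳ t = ∣-refl
fib-∣-fib-* m@(suc m-1) (suc t) rewrite fib-+ m-1 (t * m) =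
  ∣m∣n⇒∣m+n (m∣m*n _) (∣n⇒∣m*n (fib m-1) (fib-∣-fib-* m t))

∣⇒fib∣fib : ∀ {m n} → m ∣ n → fib m ∣ fib n
∣⇒fib∣fib {m} (divides t refl) = fib-∣-fib-* m t

fib∣fib[m+n]⇒fib∣fib[n] : ∀ m n → fib m ∣ fib (m + n) → fib m ∣ fib n
fib∣fib[m+n]⇒fib∣fib[n] m zero _ = fib m ∣0
fib∣fib[m+n]⇒fib∣fib[n] m (suc n) F[m]∣F[m+n] rewrite +-suc m n | fib-+ m n
  | +-comm (fib (suc m) * fib (suc n)) (fib m * fib n) =
  coprime-divisor (fib-coprime-suc m) (∣m+n∣m⇒∣n F[m]∣F[m+n] (m∣m*n (fib n)))

fib∣fib[t*m+n]⇒fib∣fib[n] : ∀ m t n → fib m ∣ fib (t * m + n) → fib m ∣ fib n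
fib∣fib[t*m+n]⇒fib∣fib[n] m zero n = id
fib∣fib[t*m+n]⇒fib∣fib[n] m (suc t) n rewrite +-assoc m (t * m) n =
  fib∣fib[t*m+n]⇒fib∣fib[n] m t n ∘ fib∣fib[m+n]⇒fib∣fib[n] m (t * m + n)

fib∣fib⇒∣ : ∀ {m n} → 3 ≤ m → fib m ∣ fib n → m ∣ n
fib∣fib⇒∣ {m@(suc (suc (suc _)))} {n} 3≤m@(s≤s (s≤s (s≤s _))) F[m]∣F[n] with n % m in n%m≡r
... | zero = m%n≡0⇒n∣m n m n%m≡r
... | suc r =
  ⊥-elim (<⇒≱ (fib-mono-< 3≤m r<m) (∣⇒≤ ⦃ >-nonZero (fib-pos {suc r} z<s) ⦄ F[m]∣F[r]))
  where
  r<m : suc r < m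
  r<m = subst (_< m) n%m≡r (m%n<n n m)
  n≡[n/m]*m+r : n ≡ n / m * m + suc r
  n≡[n/m]*m+r = trans (m≡m%n+[m/n]*n n m) (trans (cong (_+ n / m * m) n%m≡r) (+-comm (suc r) (n / m * m)))
  F[m]∣F[r] : fib m ∣ fib (suc r)
  F[m]∣F[r] = fib∣fib[t*m+n]⇒fib∣fib[n] m (n / m) (suc r)
    (subst (λ k → fib m ∣ fib k) n≡[n/m]*m+r F[m]∣F[n])

+fib-+ : ∀ a b → + fib (suc (a + b)) ≡ + fib (suc a) ℤ.* + fib (suc b) ℤ.+ + fib a ℤ.* + fib b
+fib-+ a b = begin
  + fib (suc (a + b))
    ≡⟨ cong +_ (fib-+ a b) ⟩
  + (fib (suc a) * fib (suc b)) ℤ.+ + (fib a * fib b)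
    ≡⟨ cong₂ ℤ._+_ (ℤ.pos-* (fib (suc a)) (fib (suc b))) (ℤ.pos-* (fib a) (fib b)) ⟩
  + fib (suc a) ℤ.* + fib (suc b) ℤ.+ + fib a ℤ.* + fib b ∎
  where open ≡-Reasoning

∣m-n∣n⇒∣m : ∀ {i m n} → i ℤ.∣ m ℤ.- n → i ℤ.∣ n → i ℤ.∣ m
∣m-n∣n⇒∣m {i} {m} {n} i∣m-n i∣n =
  subst (i ℤ.∣_) (m-n+n≡m m n) (ℤ.∣m∣n⇒∣m+n i∣m-n i∣n)
  where
  m-n+n≡m : ∀ m n → m ℤ.- n ℤ.+ n ≡ m
  m-n+n≡m = ℤ-Solver.solve-∀

module _ {t-1 y : ℕ} (y∣F[t] : y ∣ fib (suc t-1)) where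
  private
    t = suc t-1
    F G Y : ℤ
    F = + fib t
    G = + fib t-1
    Y = + y
    Y∣F : Y ℤ.∣ F
    Y∣F = ℤ.∣ᵤ⇒∣ y∣F[t]

  fib[1+t*s]-mod-y : ∀ s → Y ℤ.∣ + fib (suc (t * s)) ℤ.- G ℤ.^ s
  fib[1+t*s]-mod-y zero rewrite *-zeroʳ t = ℤ.∣ᵤ⇒∣ (y ∣0)
  fib[1+t*s]-mod-y (suc s) = subst (Y ℤ.∣_) (sym regrouped)
    (ℤ.∣m∣n⇒∣m+n (ℤ.∣n⇒∣m*n G (fib[1+t*s]-mod-y s)) (ℤ.∣n⇒∣m*n (X ℤ.+ Z) Y∣F))
    where
    X = + fib (suc (t * s))
    Z = + fib (t * s)
    ring : ∀ X Z F G W →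
      X ℤ.* (F ℤ.+ G) ℤ.+ Z ℤ.* F ℤ.- G ℤ.* W ≡ G ℤ.* (X ℤ.- W) ℤ.+ (X ℤ.+ Z) ℤ.* F
    ring = ℤ-Solver.solve-∀
    regrouped : + fib (suc (t * suc s)) ℤ.- G ℤ.^ suc s ≡ G ℤ.* (X ℤ.- G ℤ.^ s) ℤ.+ (X ℤ.+ Z) ℤ.* F
    regrouped = begin
      + fib (suc (t * suc s)) ℤ.- G ℤ.^ suc s
        ≡⟨ cong (λ k → + fib (suc k) ℤ.- G ℤ.^ suc s) (trans (*-suc t s) (+-comm t (t * s))) ⟩
      + fib (suc (t * s + t)) ℤ.- G ℤ.^ suc s
        ≡⟨ cong (ℤ._- G ℤ.^ suc s) (+fib-+ (t * s) t) ⟩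
      X ℤ.* (F ℤ.+ G) ℤ.+ Z ℤ.* F ℤ.- G ℤ.* G ℤ.^ s
        ≡⟨ ring X Z F G (G ℤ.^ s) ⟩
      G ℤ.* (X ℤ.- G ℤ.^ s) ℤ.+ (X ℤ.+ Z) ℤ.* F ∎
      where open ≡-Reasoning

  fib[t*s]-mod-y² : ∀ s → Y ℤ.* Y ℤ.∣ + fib (t * suc s) ℤ.- + suc s ℤ.* F ℤ.* G ℤ.^ s
  fib[t*s]-mod-y² zero = subst (Y ℤ.* Y ℤ.∣_) (sym F[t]-F[t]≡0) (ℤ.∣ᵤ⇒∣ (_ ∣0))
    where
    ring : ∀ F → F ℤ.- + 1 ℤ.* F ℤ.* ℤ.1ℤ ≡ ℤ.0ℤ
    ring = ℤ-Solver.solve-∀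
    F[t]-F[t]≡0 : + fib (t * 1) ℤ.- + 1 ℤ.* F ℤ.* ℤ.1ℤ ≡ ℤ.0ℤ
    F[t]-F[t]≡0 = trans (cong (λ k → + fib k ℤ.- + 1 ℤ.* F ℤ.* ℤ.1ℤ) (*-identityʳ t)) (ring F)
  fib[t*s]-mod-y² (suc s) = subst (Y ℤ.* Y ℤ.∣_) (sym regrouped)
    (ℤ.∣m∣n⇒∣m+n
      (ℤ.∣-trans (ℤ.*-monoʳ-∣ Y (fib[1+t*s]-mod-y (suc s))) (ℤ.*-monoˡ-∣ (X ℤ.- G ℤ.^ suc s) Y∣F))
      (ℤ.∣n⇒∣m*n G (fib[t*s]-mod-y² s)))
    where
    X = + fib (suc (t * suc s))
    Z = + fib (t * suc s)
    ring : ∀ X Z F G W S → X ℤ.* F ℤ.+ Z ℤ.* G ℤ.- (ℤ.1ℤ ℤ.+ S) ℤ.* F ℤ.* (G ℤ.* W)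
                         ≡ F ℤ.* (X ℤ.- G ℤ.* W) ℤ.+ G ℤ.* (Z ℤ.- S ℤ.* F ℤ.* W)
    ring = ℤ-Solver.solve-∀
    regrouped : + fib (t * suc (suc s)) ℤ.- + suc (suc s) ℤ.* F ℤ.* G ℤ.^ suc s
              ≡ F ℤ.* (X ℤ.- G ℤ.^ suc s) ℤ.+ G ℤ.* (Z ℤ.- + suc s ℤ.* F ℤ.* G ℤ.^ s)
    regrouped = begin
      + fib (t * suc (suc s)) ℤ.- + suc (suc s) ℤ.* F ℤ.* G ℤ.^ suc s
        ≡⟨ cong (λ k → + fib k ℤ.- + suc (suc s) ℤ.* F ℤ.* G ℤ.^ suc s)
                (trans (*-suc t (suc s)) (trans (+-comm t (t * suc s)) (+-suc (t * suc s) t-1))) ⟩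
      + fib (suc (t * suc s + t-1)) ℤ.- + suc (suc s) ℤ.* F ℤ.* G ℤ.^ suc s
        ≡⟨ cong (ℤ._- + suc (suc s) ℤ.* F ℤ.* G ℤ.^ suc s) (+fib-+ (t * suc s) t-1) ⟩
      X ℤ.* F ℤ.+ Z ℤ.* G ℤ.- + suc (suc s) ℤ.* F ℤ.* G ℤ.^ suc s
        ≡⟨ ring X Z F G (G ℤ.^ s) (+ suc s) ⟩
      F ℤ.* (X ℤ.- G ℤ.^ suc s) ℤ.+ G ℤ.* (Z ℤ.- + suc s ℤ.* F ℤ.* G ℤ.^ s) ∎
      where open ≡-Reasoning

-- Take s = x in the congruence modulo y²: x y divides both y² and x · F_t · F_{t-1}^{x-1}.
fib-lifting : ∀ {x y} t → x ∣ y → y ∣ fib t → x * y ∣ fib (t * x)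
fib-lifting {x} {y} zero _ _ = (x * y) ∣0
fib-lifting {zero} t _ _ rewrite *-zeroʳ t = 0 ∣0
fib-lifting {x@(suc s)} {y} t@(suc t-1) x∣y y∣F[t] =
  ℤ.∣⇒∣ᵤ (∣m-n∣n⇒∣m {m = + fib (t * x)}
    (ℤ.∣-trans xy∣y*y (fib[t*s]-mod-y² {t-1} y∣F[t] s)) xy∣xFGˢ)
  where
  xy∣y*y : + (x * y) ℤ.∣ + y ℤ.* + y
  xy∣y*y = subst (+ (x * y) ℤ.∣_) (ℤ.pos-* y y) (ℤ.∣ᵤ⇒∣ (*-monoˡ-∣ y x∣y))
  xy∣xFGˢ : + (x * y) ℤ.∣ + x ℤ.* + fib t ℤ.* (+ fib t-1) ℤ.^ s
  xy∣xFGˢ = subst (ℤ._∣ + x ℤ.* + fib t ℤ.* (+ fib t-1) ℤ.^ s) (sym (ℤ.pos-* x y))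
    (ℤ.∣m⇒∣m*n ((+ fib t-1) ℤ.^ s) (ℤ.*-monoʳ-∣ (+ x) {+ y} {+ fib t} (ℤ.∣ᵤ⇒∣ y∣F[t])))

fib-power-lifting : ∀ {d t} → d ∣ fib t → ∀ r → d ^ suc r ∣ fib (t * d ^ r)
fib-power-lifting {d} {t} d∣F[t] zero =
  subst₂ (λ e k → e ∣ fib k) (sym (*-identityʳ d)) (sym (*-identityʳ t)) d∣F[t]
fib-power-lifting {d} {t} d∣F[t] (suc r) =
  subst (λ k → d ^ suc (suc r) ∣ fib k) (*-comm-middle t (d ^ r) d)
    (fib-lifting (t * d ^ r) (divides (d ^ r) (*-comm d (d ^ r))) (fib-power-lifting {t = t} d∣F[t] r))
  where
  *-comm-middle : ∀ a b c → a * b * c ≡ a * (c * b)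
  *-comm-middle = solve-∀

valFuel-spec : ∀ q fuel m → 0 < m → m ≤ fuel →
  let p = suc (suc q) ; v = valFuel fuel p m in p ^ v ∣ m × ¬ p ^ suc v ∣ m
valFuel-spec q (suc fuel) m@(suc m-1) 0<m (s≤s m-1≤fuel) with suc (suc q) ∣? m
... | no p∤m = divides m (sym (*-identityʳ m)) , p∤m ∘ subst (_∣ m) (*-identityʳ p)
  where p = suc (suc q)
... | yes p∣m = subst (p * p ^ v ∣_) p*m/p≡m (*-monoʳ-∣ p p^v∣m/p)
              , λ p^[2+v]∣m → p^[1+v]∤m/p
                  (*-cancelˡ-∣ p (subst (p * (p * p ^ v) ∣_) (sym p*m/p≡m) p^[2+v]∣m))
  where
  p = suc (suc q)
  p*m/p≡m : p * (m / p) ≡ m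
  p*m/p≡m = m*[n/m]≡n p∣m
  m/p≤fuel : m / p ≤ fuel
  m/p≤fuel = ≤-trans (≤-pred (m/n<m m p (s≤s (s≤s z≤n)))) m-1≤fuel
  spec = valFuel-spec q fuel (m / p) (∣⇒pos (divides p (sym p*m/p≡m)) 0<m) m/p≤fuel
  v = valFuel fuel p (m / p)
  p^v∣m/p = proj₁ spec
  p^[1+v]∤m/p = proj₂ spec

^-monoʳ-∣ : ∀ p {i j} → i ≤ j → p ^ i ∣ p ^ j
^-monoʳ-∣ p {i} i≤j with m≤n⇒∃[o]m+o≡n i≤j
... | o , refl = divides (p ^ o) (trans (^-distribˡ-+-* p i o) (*-comm (p ^ i) (p ^ o)))

p^val∣ : ∀ {p m} → 1 < p → 0 < m → p ^ val p m ∣ m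
p^val∣ {suc (suc q)} {m} (s≤s (s≤s _)) 0<m = proj₁ (valFuel-spec q m m 0<m ≤-refl)

p^suc-val∤ : ∀ {p m} → 1 < p → 0 < m → ¬ p ^ suc (val p m) ∣ m
p^suc-val∤ {suc (suc q)} {m} (s≤s (s≤s _)) 0<m = proj₂ (valFuel-spec q m m 0<m ≤-refl)

≤val⇒p^∣ : ∀ {p m t} → 1 < p → 0 < m → t ≤ val p m → p ^ t ∣ m
≤val⇒p^∣ {p} 1<p 0<m t≤v = ∣-trans (^-monoʳ-∣ p t≤v) (p^val∣ 1<p 0<m)

p^∣⇒≤val : ∀ {p m} t → 1 < p → 0 < m → p ^ t ∣ m → t ≤ val p m
p^∣⇒≤val {p} {m} t 1<p 0<m p^t∣m with t ≤? val p m
... | yes t≤v = t≤v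
... | no t≰v = ⊥-elim (p^suc-val∤ 1<p 0<m (∣-trans (^-monoʳ-∣ p (≰⇒> t≰v)) p^t∣m))

val-mono-∣ : ∀ {p d m} → 1 < p → 0 < m → d ∣ m → val p d ≤ val p m
val-mono-∣ {p} {d} 1<p 0<m d∣m =
  p^∣⇒≤val (val p d) 1<p 0<m (∣-trans (p^val∣ 1<p (∣⇒pos d∣m 0<m)) d∣m)

prime⇒1<p : ∀ {p} → Prime p → 1 < p
prime⇒1<p {p} p-prime = nonTrivial⇒n>1 p ⦃ prime⇒nonTrivial p-prime ⦄

p^suc-val∣⇒p*∣ : ∀ {p m n} → Prime p → 0 < m → m ∣ n → p ^ suc (val p m) ∣ n → p * m ∣ n
p^suc-val∣⇒p*∣ {p} {m} {n} p-prime 0<m (divides c refl) p^[1+v]∣n =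
  *-monoˡ-∣ m ([ id , ⊥-elim ∘ p∤h ]′ (euclidsLemma c h p-prime p∣c*h))
  where
  1<p = prime⇒1<p p-prime
  v = val p m
  p^v∣m = p^val∣ 1<p 0<m
  h = quotient p^v∣m
  m≡h*p^v : m ≡ h * p ^ v
  m≡h*p^v = _∣_.equality p^v∣m
  p∤h : ¬ p ∣ h
  p∤h p∣h = p^suc-val∤ 1<p 0<m (subst (p ^ suc v ∣_) (sym m≡h*p^v) (*-monoˡ-∣ (p ^ v) p∣h))
  p∣c*h : p ∣ c * h
  p∣c*h = *-cancelʳ-∣ (p ^ v) ⦃ >-nonZero (∣⇒pos p^v∣m 0<m) ⦄
    (subst (p ^ suc v ∣_) (trans (cong (c *_) m≡h*p^v) (sym (*-assoc c h (p ^ v)))) p^[1+v]∣n)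

product*∣-by-valuations : ∀ {ps L n b} → All Prime ps → 0 < n → 0 < b → product ps * L ∣ b →
  L ∣ n → All (λ p → val p b ≤ val p n) ps → product ps * L ∣ n
product*∣-by-valuations {[]} {L} _ _ _ _ L∣n [] = subst (_∣ _) (sym (*-identityˡ L)) L∣n
product*∣-by-valuations {p ∷ ps} {L} {n} {b} (p-prime ∷ ps-prime) 0<n 0<b pM∣b L∣n
  (vb≤vn ∷ vb≤vns) =
  subst (_∣ n) (sym (*-assoc p (product ps) L)) (p^suc-val∣⇒p*∣ p-prime 0<M M∣n p^[1+v]∣n)
  where
  M = product ps * L
  1<p = prime⇒1<p p-prime
  p*M∣b : p * M ∣ b
  p*M∣b = subst (_∣ b) (*-assoc p (product ps) L) pM∣b
  M∣b : M ∣ b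
  M∣b = ∣-trans (n∣m*n p) p*M∣b
  0<M : 0 < M
  0<M = ∣⇒pos M∣b 0<b
  M∣n : M ∣ n
  M∣n = product*∣-by-valuations ps-prime 0<n 0<b M∣b L∣n vb≤vns
  p^[1+v]∣b : p ^ suc (val p M) ∣ b
  p^[1+v]∣b = ∣-trans (*-monoʳ-∣ p (p^val∣ 1<p 0<M)) p*M∣b
  p^[1+v]∣n : p ^ suc (val p M) ∣ n
  p^[1+v]∣n = ≤val⇒p^∣ 1<p 0<n (≤-trans (p^∣⇒≤val (suc (val p M)) 1<p 0<b p^[1+v]∣b) vb≤vn)

*∣-by-valuations : ∀ {f L n} → 0 < n → 0 < f * L → L ∣ n →
  (∀ p → Prime p → p ∣ f → val p (f * L) ≤ val p n) → f * L ∣ n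
*∣-by-valuations {f} {L} {n} 0<n 0<fL L∣n vfL≤vn =
  subst (λ f → f * L ∣ n) (sym f≡∏ps)
    (product*∣-by-valuations factorsPrime 0<n 0<∏ps*L ∣-refl L∣n
      (tabulate (λ {p} p∈ps → subst (λ f → val p (f * L) ≤ val p n) f≡∏ps
        (vfL≤vn p (lookup factorsPrime p∈ps) (subst (p ∣_) (sym f≡∏ps) (∈⇒∣product p∈ps))))))
  where
  open PrimeFactorisation (factorise f ⦃ >-nonZero (∣⇒pos (m∣m*n L) 0<fL) ⦄)
  f≡∏ps : f ≡ product factors
  f≡∏ps = isFactorisation
  0<∏ps*L : 0 < product factors * L
  0<∏ps*L = subst (λ f → 0 < f * L) f≡∏ps 0<fL

∃-IsLeastPos : ∀ {P : ℕ → Set} → Decidable P → (∃ λ w → 0 < w × P w) → ∃ (IsLeastPos P)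
∃-IsLeastPos {P} P? (w , Qw) = <-rec (λ w → Q w → ∃ (IsLeastPos P)) step w Qw
  where
  Q : ℕ → Set
  Q i = 0 < i × P i
  step : ∀ w → (∀ {v} → v < w → Q v → ∃ (IsLeastPos P)) → Q w → ∃ (IsLeastPos P)
  step w rec (0<w , Pw) with anyUpTo? (λ i → 0 <? i ×-dec P? i) w
  ... | yes (v , v<w , Qv) = rec v<w Qv
  ... | no ∄v<w = w , 0<w , Pw , λ i 0<i Pi → ≮⇒≥ (λ i<w → ∄v<w (i , i<w , 0<i , Pi))

IsLeastPos-⇔ : ∀ {P Q : ℕ → Set} {j} → (∀ i → 0 < i → P i → Q i) → (∀ i → 0 < i → Q i → P i) →
  IsLeastPos P j → IsLeastPos Q j
IsLeastPos-⇔ P⇒Q Q⇒P (0<j , Pj , j-least) =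
  0<j , P⇒Q _ 0<j Pj , λ i 0<i Qi → j-least i 0<i (Q⇒P i 0<i Qi)

IsLeastPos⇒IsOrderOfAppearance : ∀ {a b j} → 0 < a → (∀ {N} → b ∣ fib N → a ∣ N) →
  IsLeastPos (λ i → b ∣ fib (a * i)) j → IsOrderOfAppearance b (a * j)
IsLeastPos⇒IsOrderOfAppearance {a} {b} {j} 0<a a∣ (0<j , b∣F[aj] , j-least) =
  *-pos 0<a 0<j , b∣F[aj] , λ N 0<N b∣F[N] → a*j≤multiple 0<N b∣F[N] (a∣ b∣F[N])
  where
  a*j≤multiple : ∀ {N} → 0 < N → b ∣ fib N → a ∣ N → a * j ≤ N
  a*j≤multiple 0<N b∣F[N] (divides t refl) = subst (a * j ≤_) (*-comm a t) (*-monoʳ-≤ a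
    (j-least t (∣⇒pos (divides a (*-comm t a)) 0<N) (subst (λ N → b ∣ fib N) (*-comm t a) b∣F[N])))

lcmList-least : ∀ xs {c} → All (_∣ c) xs → lcmList xs ∣ c
lcmList-least [] [] = 1∣ _
lcmList-least (_ ∷ xs) (x∣c ∷ xs∣c) = lcm-least x∣c (lcmList-least xs xs∣c)

∈⇒∣lcmList : ∀ {x xs} → x ∈ xs → x ∣ lcmList xs
∈⇒∣lcmList {xs = y ∷ ys} (here refl) = m∣lcm[m,n] y (lcmList ys)
∈⇒∣lcmList {xs = y ∷ ys} (there x∈ys) = ∣-trans (∈⇒∣lcmList x∈ys) (n∣lcm[m,n] y (lcmList ys))

product∣^length : ∀ xs {d} → All (_∣ d) xs → product xs ∣ d ^ length xs
product∣^length [] [] = ∣-refl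
product∣^length (_ ∷ xs) (x∣d ∷ xs∣d) = *-pres-∣ x∣d (product∣^length xs xs∣d)

∈range⇒≤ : ∀ {m n k} → m ∈ range n k → n ≤ m
∈range⇒≤ {n = n} m∈range with ∈-map⁻ (λ i → n + i) m∈range
... | i , _ , refl = m≤m+n n i

divN-spec : ∀ {m d} → 0 < d → d ∣ m → m ≡ divN m d * d
divN-spec {d = suc _} _ d∣m = sym (m/n*n≡m d∣m)

lcmRange-pos : ∀ n k → 0 < n → 0 < lcmRange n k
lcmRange-pos n k 0<n = ∣⇒pos (lcmList-least (range n k) (tabulate ∈⇒∣product)) (>-nonZero⁻¹ _
  ⦃ product≢0 (tabulate {xs = range n k} (λ m∈R → >-nonZero (≤-trans 0<n (∈range⇒≤ m∈R)))) ⦄)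

fibProd-pos : ∀ n k → 0 < n → 0 < fibProd n k
fibProd-pos n k 0<n = >-nonZero⁻¹ _ ⦃ product≢0 (map⁺ (tabulate {xs = range n k}
  (λ m∈R → >-nonZero (fib-pos (≤-trans 0<n (∈range⇒≤ m∈R)))))) ⦄

lcmRange∣⇒fibLcm∣fib : ∀ n k {N} → lcmRange n k ∣ N → fibLcm n k ∣ fib N
lcmRange∣⇒fibLcm∣fib n k a∣N = lcmList-least (map fib (range n k))
  (map⁺ (tabulate {xs = range n k} (λ m∈R → ∣⇒fib∣fib (∣-trans (∈⇒∣lcmList m∈R) a∣N))))

fibProd≡fk*fibLcm : ∀ n k → 0 < n → fibProd n k ≡ fk k n * fibLcm n k
fibProd≡fk*fibLcm n k 0<n = divN-spec (∣⇒pos L∣b (fibProd-pos n k 0<n)) L∣b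
  where
  L∣b : fibLcm n k ∣ fibProd n k
  L∣b = lcmList-least (map fib (range n k)) (tabulate ∈⇒∣product)

fibProd∣fib⇒lcmRange∣ : ∀ n k {N} → 3 ≤ n → fibProd n k ∣ fib N → lcmRange n k ∣ N
fibProd∣fib⇒lcmRange∣ n k 3≤n b∣F[N] = lcmList-least (range n k) (tabulate (λ m∈R →
  fib∣fib⇒∣ (≤-trans 3≤n (∈range⇒≤ m∈R)) (∣-trans (∈⇒∣product (∈-map⁺ fib m∈R)) b∣F[N])))

fibProd∣fib[lcmRange*_] : ∀ n k → 0 < n → ∃ λ w → 0 < w × fibProd n k ∣ fib (lcmRange n k * w)
fibProd∣fib[lcmRange*_] n k 0<n =
  fib a ^ e , m^n>0 (fib a) ⦃ >-nonZero (fib-pos (lcmRange-pos n k 0<n)) ⦄ e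
  , ∣-trans b∣F[a]^e (∣-trans (^-monoʳ-∣ (fib a) (n≤1+n e)) (fib-power-lifting {t = a} ∣-refl e))
  where
  a = lcmRange n k
  e = length (map fib (range n k))
  b∣F[a]^e : fibProd n k ∣ fib a ^ e
  b∣F[a]^e = product∣^length (map fib (range n k))
    (map⁺ (tabulate {xs = range n k} (∣⇒fib∣fib ∘ ∈⇒∣lcmList)))

theorem3p1 : ∀ (n k : ℕ) → 3 ≤ n → 1 ≤ k →
    ((∀ (j : ℕ) → 1 ≤ j → fibProd n k ∣ fk k n * fib (lcmRange n k * j))
    × ∃ (λ (j : ℕ) →
        IsLeastPos (λ i → fibProd n k ∣ fib (lcmRange n k * i)) j
        × IsOrderOfAppearance (fibProd n k) (lcmRange n k * j)
        × IsLeastPos (λ i → ∀ (p : ℕ) → Prime p → p ∣ fk k n →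
              val p (fibProd n k) ≤ val p (fib (lcmRange n k * i))) j))
theorem3p1 n k 3≤n _ =
  part-i , j , j-least , IsLeastPos⇒IsOrderOfAppearance 0<a (fibProd∣fib⇒lcmRange∣ n k 3≤n) j-least
  , IsLeastPos-⇔ b∣⇒valuations valuations⇒b∣ j-least
  where
  0<n = ≤-trans (s≤s z≤n) 3≤n
  a = lcmRange n k
  b = fibProd n k
  f = fk k n
  0<a = lcmRange-pos n k 0<n
  b≡f*L = fibProd≡fk*fibLcm n k 0<n
  L∣F[a*_] : ∀ i → fibLcm n k ∣ fib (a * i)
  L∣F[a*_] i = lcmRange∣⇒fibLcm∣fib n k (m∣m*n i)
  part-i : ∀ j → 1 ≤ j → b ∣ f * fib (a * j)
  part-i j _ = subst (_∣ f * fib (a * j)) (sym b≡f*L) (*-monoʳ-∣ f (L∣F[a*_] j))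
  least = ∃-IsLeastPos (λ i → b ∣? fib (a * i)) (fibProd∣fib[lcmRange*_] n k 0<n)
  j = proj₁ least
  j-least = proj₂ least
  ValuationsBounded : ℕ → Set
  ValuationsBounded i = ∀ p → Prime p → p ∣ f → val p b ≤ val p (fib (a * i))
  b∣⇒valuations : ∀ i → 0 < i → b ∣ fib (a * i) → ValuationsBounded i
  b∣⇒valuations i 0<i b∣F p p-prime _ = val-mono-∣ (prime⇒1<p p-prime) (fib-pos (*-pos 0<a 0<i)) b∣F
  valuations⇒b∣ : ∀ i → 0 < i → ValuationsBounded i → b ∣ fib (a * i)
  valuations⇒b∣ i 0<i vb≤vF = subst (_∣ fib (a * i)) (sym b≡f*L)
    (*∣-by-valuations (fib-pos (*-pos 0<a 0<i)) (subst (0 <_) b≡f*L (fibProd-pos n k 0<n))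
      (L∣F[a*_] i) (λ p p-prime p∣f → subst (λ b → val p b ≤ val p (fib (a * i))) b≡f*L
                                             (vb≤vF p p-prime p∣f)))
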